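{- Let $G$ be a connected graph and let $x,y$ be vertices with $d(x,y)=2$. Let $z\in\overline{xy}^G$ with $z\notin N_G(x)\cap N_G(y)$, and let $P$ be a path between $z$ and $x$ all of whose vertices lie in $\overline{xy}^G$ and which does not contain $y$. Then $d(z,y)=d(z,x)+d(x,y)$.
   Context: Graphs are finite and simple; $d$ is the shortest-path distance and $N_G(v)$ the neighborhood of $v$. For distinct vertices $x,y$, $\overline{xy}^G=\{z: d(x,y)=d(x,z)+d(z,y)\ \text{or}\ d(x,y)=|d(x,z)-d(z,y)|\}$. -}

module Defs where

open import Level using (0ℓ)
open import Data.Nat using (ℕ; zero; suc; _+_; _≤_; ∣_-_∣)
open import Data.Fin using (Fin)
open import Data.List using (List; []; _∷_; length)
open import Data.List.Membership.Propositional using (_∈_)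
open import Data.List.Relation.Unary.All using (All)
open import Data.List.Relation.Unary.Unique.Propositional using (Unique)
open import Data.Product using (Σ; _×_; ∃; ∃-syntax)
open import Data.Sum using (_⊎_)
open import Relation.Nullary using (¬_)
open import Relation.Binary.PropositionalEquality using (_≡_)

record Graph (n : ℕ) : Set₁ where
  field
    Adj     : Fin n → Fin n → Set
    sym     : ∀ {u v} → Adj u v → Adj v u
    irrefl  : ∀ {u} → ¬ Adj u u

module _ {n : ℕ} (G : Graph n) where
  open Graph G

  data Walk : Fin n → Fin n → ℕ → Set where
    [_]  : (u : Fin n) → Walk u u 0
    _∷⟨_⟩_ : (u : Fin n) {v w : Fin n} {k : ℕ} → Adj u v → Walk v w k → Walk u w (suc k)

  vertices : ∀ {u v k} → Walk u v k → List (Fin n)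
  vertices [ u ] = u ∷ []
  vertices (u ∷⟨ _ ⟩ p) = u ∷ vertices p

  record Path (u v : Fin n) : Set where
    constructor path
    field
      len    : ℕ
      walk   : Walk u v len
      unique : Unique (vertices walk)

  Connected : Set
  Connected = ∀ (u v : Fin n) → ∃[ k ] Walk u v k

  Dist : Fin n → Fin n → ℕ → Set
  Dist u v k = Walk u v k × (∀ {m} → Walk u v m → k ≤ m)

  Nbr : Fin n → Fin n → Set
  Nbr v w = Adj v w

  InInterval : Fin n → Fin n → Fin n → Set
  InInterval x y z =
    Σ ℕ λ a → Σ ℕ λ b → Σ ℕ λ c →
      Dist x y a × Dist x z b × Dist z y c ×
      (a ≡ b + c ⊎ a ≡ ∣ b - c ∣)

module Submission where

-- Let d(x,y) = 2.  A vertex v of the interval xy‾ has distances b = d(x,v),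
-- c = d(v,y) with 2 = b + c or 2 = |b - c|, so it sits in exactly one of three
-- positions: on the x-side (c = b + 2), in the middle (b = c = 1, a common
-- neighbour of x and y), or on the y-side (b = c + 2; this includes y itself).
--
-- The key observation is that a walk inside the interval cannot leave the
-- y-side except through y: if u is on the y-side and its neighbour v is not,
-- the triangle inequalities d(x,u) ≤ d(x,v) + 1 and d(v,y) ≤ d(u,y) + 1 force
-- d(u,y) = 0.  Walking backwards from x (which is on the x-side) along a path
-- inside the interval that avoids y therefore never meets the y-side.  The
-- start z of the path is thus on the x-side or in the middle, and the middle is
-- excluded by hypothesis, so d(z,y) = d(z,x) + 2.

open import Defs
open import Data.Nat using (ℕ; _+_; zero; suc; _≤_; s≤s⁻¹; ∣_-_∣)
open import Data.Nat.Properties using (≤-antisym; n≤0⇒n≡0; <-asym; +-comm)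
open import Data.Fin using (Fin)
open import Data.Empty using (⊥-elim)
open import Data.Product using (_×_; _,_; proj₁)
open import Data.Sum using (_⊎_; inj₁; inj₂)
open import Data.List.Membership.Propositional using (_∈_)
open import Data.List.Relation.Unary.All using (All; _∷_)
open import Data.List.Relation.Unary.Any using (here; there)
open import Relation.Nullary using (¬_)
open import Relation.Binary.PropositionalEquality using (_≡_; refl; sym; cong; subst; module ≡-Reasoning)

data Position : ℕ → ℕ → Set where
  x-side : ∀ b → Position b (2 + b)
  middle : Position 1 1
  y-side : ∀ c → Position (2 + c) c

apart-by-two : ∀ b c → 2 ≡ ∣ b - c ∣ → Position b c
apart-by-two zero    c       refl = x-side 0
apart-by-two (suc b) zero    refl = y-side 0
apart-by-two (suc b) (suc c) e with apart-by-two b c e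
... | x-side _ = x-side (suc b)
... | y-side _ = y-side (suc c)
apart-by-two (suc _) (suc _) () | middle

position : ∀ b c → 2 ≡ b + c ⊎ 2 ≡ ∣ b - c ∣ → Position b c
position zero                c    (inj₁ refl) = x-side 0
position (suc zero)          c    (inj₁ refl) = middle
position (suc (suc zero))    zero (inj₁ refl) = y-side 0
position (suc (suc (suc _))) _    (inj₁ ())
position b c (inj₂ e) = apart-by-two b c e

-- Arithmetic core of the invariant: a vertex u on the y-side (d(x,u) = 2 + cu)
-- adjacent to a vertex v in a position other than the y-side must have
-- d(u,y) = cu = 0, given the two triangle inequalities along the edge uv.
leave-y-side : ∀ {bv cv cu} → Position bv cv → ¬ bv ≡ 2 + cv →
               2 + cu ≤ suc bv → cv ≤ suc cu → cu ≡ 0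
leave-y-side (x-side bv) _ bu≤ cv≤ = ⊥-elim (<-asym (s≤s⁻¹ bu≤) (s≤s⁻¹ cv≤))
leave-y-side middle      _ bu≤ _   = n≤0⇒n≡0 (s≤s⁻¹ (s≤s⁻¹ bu≤))
leave-y-side (y-side _)  notY _ _  = ⊥-elim (notY refl)

module _ {n : ℕ} (G : Graph n) where
  open Graph G using (Adj)

  snoc : ∀ {u v w k} → Walk G u v k → Adj v w → Walk G u w (suc k)
  snoc [ u ]        e = u ∷⟨ e ⟩ [ _ ]
  snoc (u ∷⟨ a ⟩ p) e = u ∷⟨ a ⟩ snoc p e

  reverse : ∀ {u v k} → Walk G u v k → Walk G v u k
  reverse [ u ]        = [ u ]
  reverse (u ∷⟨ a ⟩ p) = snoc (reverse p) (Graph.sym G a)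

  walk-length-0 : ∀ {u v} → Walk G u v 0 → u ≡ v
  walk-length-0 [ u ] = refl

  walk-length-1 : ∀ {u v} → Walk G u v 1 → Adj u v
  walk-length-1 (_ ∷⟨ e ⟩ [ _ ]) = e

  All-first : ∀ {P : Fin n → Set} {u v k} (w : Walk G u v k) →
              All P (vertices G w) → P u
  All-first [ _ ]        (p ∷ _) = p
  All-first (_ ∷⟨ _ ⟩ _) (p ∷ _) = p

  dist-unique : ∀ {u v a b} → Dist G u v a → Dist G u v b → a ≡ b
  dist-unique (p , min-p) (q , min-q) = ≤-antisym (min-p q) (min-q p)

  dist-sym : ∀ {u v a b} → Dist G u v a → Dist G v u b → a ≡ b
  dist-sym (p , min-p) (q , min-q) = ≤-antisym (min-p (reverse q)) (min-q (reverse p))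

  dist-from-step : ∀ {x u v a b} → Dist G x u a → Dist G x v b → Adj v u → a ≤ suc b
  dist-from-step (_ , min-u) (p , _) e = min-u (snoc p e)

  dist-to-step : ∀ {y u v a b} → Dist G u y a → Dist G v y b → Adj v u → b ≤ suc a
  dist-to-step (p , _) (_ , min-v) e = min-v (_ ∷⟨ e ⟩ p)

  module _ {x y : Fin n} (dxy : Dist G x y 2) where

    interval-position : ∀ {a b c} → Dist G x y a → (a ≡ b + c ⊎ a ≡ ∣ b - c ∣) →
                        Position b c
    interval-position {b = b} {c} Dxy e =
      position b c (subst (λ t → t ≡ b + c ⊎ t ≡ ∣ b - c ∣) (dist-unique Dxy dxy) e)

    avoids-y-side : ∀ {u k} (w : Walk G u x k) → All (InInterval G x y) (vertices G w) →
                    ¬ (y ∈ vertices G w) →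
                    ∀ {b c} → Dist G x u b → Dist G u y c → ¬ b ≡ 2 + c
    avoids-y-side [ _ ] _ _ (_ , min-x) _ b≡2+c
      with n≤0⇒n≡0 (subst (_≤ 0) b≡2+c (min-x [ x ]))
    ... | ()
    avoids-y-side (u ∷⟨ e ⟩ w) (_ ∷ inside) y∉ {c = c} Dxu Duy b≡2+c
      with All-first w inside
    ... | (_ , _ , _ , Dxy , Dxv , Dvy , interval-eq) =
      y∉ (here (sym (walk-length-0 (subst (Walk G u y) c≡0 (proj₁ Duy)))))
      where
        back = Graph.sym G e
        c≡0 : c ≡ 0
        c≡0 = leave-y-side (interval-position Dxy interval-eq)
                (avoids-y-side w inside (λ y∈ → y∉ (there y∈)) Dxv Dvy)
                (subst (_≤ _) b≡2+c (dist-from-step Dxu Dxv back))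
                (dist-to-step Duy Dvy back)

    start-on-x-side : ∀ {z k b c} (w : Walk G z x k) →
                      All (InInterval G x y) (vertices G w) → ¬ (y ∈ vertices G w) →
                      ¬ (Adj x z × Adj y z) → Dist G x z b → Dist G z y c →
                      Position b c → c ≡ 2 + b
    start-on-x-side _ _ _ _ _ _ (x-side _) = refl
    start-on-x-side _ _ _ not-common Dxz Dzy middle =
      ⊥-elim (not-common (walk-length-1 (proj₁ Dxz) , Graph.sym G (walk-length-1 (proj₁ Dzy))))
    start-on-x-side w inside y∉ _ Dxz Dzy (y-side _) =
      ⊥-elim (avoids-y-side w inside y∉ Dxz Dzy refl)

corollary1 : ∀ {n : ℕ} (G : Graph n) → Connected G →
    ∀ (x y z : Fin n) → Dist G x y 2 →
    InInterval G x y z →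
    ¬ (Nbr G x z × Nbr G y z) →
    (P : Path G z x) →
    All (InInterval G x y) (vertices G (Path.walk P)) →
    ¬ (y ∈ vertices G (Path.walk P)) →
    ∀ (a b : ℕ) → Dist G z y a → Dist G z x b → a ≡ b + 2
corollary1 G _ x y z dxy (_ , b′ , c′ , Dxy , Dxz , Dzy′ , interval-eq)
           not-common (path _ w _) inside y∉ a b Dzy Dzx =
  begin
    a       ≡⟨ dist-unique G Dzy Dzy′ ⟩
    c′      ≡⟨ start-on-x-side G dxy w inside y∉ not-common Dxz Dzy′
                 (interval-position G dxy Dxy interval-eq) ⟩
    2 + b′  ≡⟨ +-comm 2 b′ ⟩
    b′ + 2  ≡⟨ cong (_+ 2) (dist-sym G Dxz Dzx) ⟩
    b + 2   ∎
  where open ≡-Reasoning
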